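{- Let $\frac mn$ be a positive irreducible fraction and let $y_1,y_2,y,x$ be positive integers with $\gcd(y,y_2)=1$ such that $y_2,y_1,yn$ are pairwise distinct and \[ \frac mn=\frac1{y_2}+\frac1{y_1}+\frac{x}{yn}. \] Then this decomposition is faithful if and only if $x<y$ and $n\ne m'y_2$ for every positive integer $m'<m$.
   Context: A decomposition of a positive rational $\frac mn$ is an expression $\frac mn=\sum_{i=1}^k\frac{a_i}{b_i}$ with $a_i$ positive integers and $b_i$ pairwise distinct positive integers. For a positive irreducible fraction $u=\frac mn$, it is faithful if for all integers $0\le x_i\le a_i$, $v=\sum_i\frac{x_i}{b_i}\notin\frac1n\mathbb Z$ unless $v=u$ or $v=0$. -}

module Defs where

open import Data.Nat using (ℕ; zero; suc; _≤_; _<_)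
open import Data.Integer using (ℤ; +_)
open import Data.Rational using (ℚ; _/_; _+_; 0ℚ)
open import Data.Fin using (Fin)
open import Data.Product using (_×_; ∃)
open import Data.Sum using (_⊎_)
open import Function.Definitions using (Injective)
open import Relation.Binary.PropositionalEquality using (_≡_)

-- z / d as a rational; the value for d = 0 is an (irrelevant) junk value 0,
-- all denominators used below are positive by hypothesis.
infixl 7 _÷_
_÷_ : ℤ → ℕ → ℚ
z ÷ zero  = 0ℚ
z ÷ suc d = z / suc d

∑ : (k : ℕ) → (Fin k → ℚ) → ℚ
∑ zero    f = 0ℚ
∑ (suc k) f = f Fin.zero + ∑ k (λ i → f (Fin.suc i))

value : (k : ℕ) → (Fin k → ℕ) → (Fin k → ℕ) → ℚ
value k x b = ∑ k (λ i → (+ x i) ÷ b i)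

IsDecomposition : (m n k : ℕ) → (a b : Fin k → ℕ) → Set
IsDecomposition m n k a b =
  (∀ i → 1 ≤ a i) × (∀ i → 1 ≤ b i) × Injective _≡_ _≡_ b ×
  ((+ m) ÷ n ≡ value k a b)

InOneOverNZ : ℕ → ℚ → Set
InOneOverNZ n v = ∃ λ (z : ℤ) → v ≡ z ÷ n

Faithful : (m n k : ℕ) → (a b : Fin k → ℕ) → Set
Faithful m n k a b =
  (x : Fin k → ℕ) → (∀ i → x i ≤ a i) →
  InOneOverNZ n (value k x b) →
  (value k x b ≡ (+ m) ÷ n) ⊎ (value k x b ≡ 0ℚ)

-- Clearing the denominator y₂ y₁ y n, a sub-sum A/y₂ + B/y₁ + C/(yn) (A, B ≤ 1, C ≤ x) equals
-- k/n exactly when its numerator equals k y₂ y₁ y. A sub-sum lies in (1/n)ℤ iff its complement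
-- does, and the two numerators add up to m. When x < y, C/(yn) alone is in (1/n)ℤ only for
-- C = 0, and since gcd(y, y₂) = 1, 1/y₂ + C/(yn) = k/n forces C = 0 and n = k y₂; so the only
-- possible failures are 1/y₂ or its complement, excluded exactly by n ≠ m′ y₂ for 0 < m′ < m.
-- Conversely, if x ≥ y then y/(yn) = 1/n, and if n = m′ y₂ then 1/y₂ = m′/n.
module Submission where

open import Defs
open import Data.Empty using (⊥; ⊥-elim)
open import Data.Fin using (Fin)
open import Data.Fin.Patterns using (0F; 1F; 2F)
open import Data.Integer using (+_; -[1+_])
import Data.Integer as ℤ
import Data.Integer.Properties as ℤ
open import Data.List using (_∷_; [])
open import Data.Nat using (ℕ; zero; suc; _+_; _*_; _∸_; _≤_; _<_; NonZero; z≤n; s≤s; _<?_; ≢-nonZero⁻¹)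
open import Data.Nat.Coprimality using (Coprime; coprime-divisor)
open import Data.Nat.Divisibility using (_∣_; divides; >⇒∤; ∣m+n∣m⇒∣n; m∣m*n)
open import Data.Nat.Properties
open import Data.Nat.Tactic.RingSolver using (solve)
open import Data.Product using (_×_; _,_; proj₁; proj₂; ∃-syntax)
open import Data.Rational as ℚ using (toℚᵘ)
open import Data.Rational.Properties
  using (fromℚᵘ-injective; fromℚᵘ-cong; toℚᵘ-injective; toℚᵘ-homo-+; toℚᵘ-fromℚᵘ; 0/n≡0)
import Data.Rational.Properties as ℚₚ
open import Data.Rational.Unnormalised using (mkℚᵘ; *≡*) renaming (_+_ to _+ᵘ_)
import Data.Rational.Unnormalised.Properties as ℚᵘ
open import Data.Sum using (_⊎_; inj₁; inj₂; [_,_]′)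
open import Function.Bundles using (_⇔_; mk⇔; Equivalence)
open import Function.Properties.Equivalence using () renaming (trans to ⇔-trans)
open import Relation.Binary.PropositionalEquality
open import Relation.Nullary using (contradiction; yes; no)

open Equivalence using (to; from)

+÷≡+÷⇔ : ∀ p a q b → + p ÷ suc a ≡ + q ÷ suc b ⇔ p * suc b ≡ q * suc a
+÷≡+÷⇔ p a q b = mk⇔ cross-multiply divide
  where
  cross-multiply : + p ÷ suc a ≡ + q ÷ suc b → p * suc b ≡ q * suc a
  cross-multiply eq with fromℚᵘ-injective {mkℚᵘ (+ p) a} {mkℚᵘ (+ q) b} eq
  ... | *≡* cross = ℤ.+-injective (trans (ℤ.pos-* p (suc b)) (trans cross (sym (ℤ.pos-* q (suc a)))))
  divide : p * suc b ≡ q * suc a → + p ÷ suc a ≡ + q ÷ suc b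
  divide eq = fromℚᵘ-cong {mkℚᵘ (+ p) a} {mkℚᵘ (+ q) b}
    (*≡* (trans (sym (ℤ.pos-* p (suc b))) (trans (cong +_ eq) (ℤ.pos-* q (suc a)))))

+÷≢-÷ : ∀ p a q b → + p ÷ suc a ≢ -[1+ q ] ÷ suc b
+÷≢-÷ p a q b eq with fromℚᵘ-injective {mkℚᵘ (+ p) a} {mkℚᵘ -[1+ q ] b} eq
... | *≡* cross with trans (ℤ.pos-* p (suc b)) cross
... | ()

+÷-+-+÷ : ∀ p a q b → (+ p ÷ suc a) ℚ.+ (+ q ÷ suc b) ≡ + (p * suc b + q * suc a) ÷ (suc a * suc b)
+÷-+-+÷ p a q b = toℚᵘ-injective (begin
  toℚᵘ ((+ p ÷ suc a) ℚ.+ (+ q ÷ suc b))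
    ≈⟨ toℚᵘ-homo-+ (+ p ÷ suc a) (+ q ÷ suc b) ⟩
  toℚᵘ (+ p ÷ suc a) +ᵘ toℚᵘ (+ q ÷ suc b)
    ≈⟨ ℚᵘ.+-cong (toℚᵘ-fromℚᵘ (mkℚᵘ (+ p) a)) (toℚᵘ-fromℚᵘ (mkℚᵘ (+ q) b)) ⟩
  mkℚᵘ (+ p) a +ᵘ mkℚᵘ (+ q) b
    ≈⟨ *≡* (cong (ℤ._* + (suc a * suc b)) (sym numerators)) ⟩
  mkℚᵘ (+ (p * suc b + q * suc a)) (b + a * suc b)
    ≈⟨ toℚᵘ-fromℚᵘ (mkℚᵘ (+ (p * suc b + q * suc a)) (b + a * suc b)) ⟨
  toℚᵘ (+ (p * suc b + q * suc a) ÷ (suc a * suc b)) ∎)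
  where
  open ℚᵘ.≃-Reasoning
  numerators : + (p * suc b + q * suc a) ≡ + p ℤ.* + suc b ℤ.+ + q ℤ.* + suc a
  numerators = trans (ℤ.pos-+ (p * suc b) (q * suc a)) (cong₂ ℤ._+_ (ℤ.pos-* p (suc b)) (ℤ.pos-* q (suc a)))

<∧∣⇒≡0 : ∀ {m n} → n < m → m ∣ n → n ≡ 0
<∧∣⇒≡0 {n = zero}  _   _   = refl
<∧∣⇒≡0 {n = suc _} n<m m∣n = contradiction m∣n (>⇒∤ n<m)

difference-of-multiples : ∀ m n {o r} .{{_ : NonZero o}} →
  m * o + r ≡ n * o → ∃[ l ] r ≡ l * o × m + l ≡ n
difference-of-multiples zero    n       eq = n , eq , refl
difference-of-multiples (suc m) zero    {o} eq =
  contradiction (m+n≡0⇒m≡0 o (m+n≡0⇒m≡0 (o + m * o) eq)) (≢-nonZero⁻¹ o)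
difference-of-multiples (suc m) (suc n) {o} {r} eq
  with difference-of-multiples m n (+-cancelˡ-≡ o (m * o + r) (n * o) (trans (sym (+-assoc o (m * o) r)) eq))
... | l , r≡lo , m+l≡n = l , r≡lo , cong suc m+l≡n

module Numerators (y₂ y₁ y n : ℕ)
  .{{_ : NonZero y₂}} .{{_ : NonZero y₁}} .{{_ : NonZero y}} .{{_ : NonZero n}} where

  open ≡-Reasoning

  numerator : ℕ → ℕ → ℕ → ℕ
  numerator A B C = A * (y₁ * y * n) + B * (y₂ * y * n) + C * (y₂ * y₁)

  scale : ℕ
  scale = y₂ * y₁ * y

  private instance
    y₂y₁≢0 : NonZero (y₂ * y₁)
    y₂y₁≢0 = m*n≢0 y₂ y₁
    y₁yn≢0 : NonZero (y₁ * y * n)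
    y₁yn≢0 = m*n≢0 (y₁ * y) n {{m*n≢0 y₁ y}}
    y₂yn≢0 : NonZero (y₂ * y * n)
    y₂yn≢0 = m*n≢0 (y₂ * y) n {{m*n≢0 y₂ y}}
    scale≢0 : NonZero scale
    scale≢0 = m*n≢0 (y₂ * y₁) y

  numerator-+ : ∀ A B C A′ B′ C′ →
    numerator A B C + numerator A′ B′ C′ ≡ numerator (A + A′) (B + B′) (C + C′)
  numerator-+ A B C A′ B′ C′ = distribute
    where
    distribute : A * (y₁ * y * n) + B * (y₂ * y * n) + C * (y₂ * y₁)
                   + (A′ * (y₁ * y * n) + B′ * (y₂ * y * n) + C′ * (y₂ * y₁))
               ≡ (A + A′) * (y₁ * y * n) + (B + B′) * (y₂ * y * n) + (C + C′) * (y₂ * y₁)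
    distribute = solve (A ∷ B ∷ C ∷ A′ ∷ B′ ∷ C′ ∷ y₂ ∷ y₁ ∷ y ∷ n ∷ [])

  numerator-1-0 : ∀ C → numerator 1 0 C ≡ y₁ * (y * n + C * y₂)
  numerator-1-0 C = factor
    where
    factor : 1 * (y₁ * y * n) + 0 * (y₂ * y * n) + C * (y₂ * y₁) ≡ y₁ * (y * n + C * y₂)
    factor = solve (C ∷ y₂ ∷ y₁ ∷ y ∷ n ∷ [])

  numerator≡0⇒ : ∀ {A B C} → numerator A B C ≡ 0 → A ≡ 0 × B ≡ 0
  numerator≡0⇒ {A} {B} eq =
    m*n≡0⇒m≡0 A (y₁ * y * n) (m+n≡0⇒m≡0 _ AB≡0) , m*n≡0⇒m≡0 B (y₂ * y * n) (m+n≡0⇒n≡0 _ AB≡0)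
    where
    AB≡0 : A * (y₁ * y * n) + B * (y₂ * y * n) ≡ 0
    AB≡0 = m+n≡0⇒m≡0 _ eq

  cleared⇔numerator≡ : ∀ A B C k →
    (A * (y₁ * (y * n)) + (B * (y * n) + C * y₁) * y₂) * n ≡ k * (y₂ * (y₁ * (y * n)))
    ⇔ numerator A B C ≡ k * scale
  cleared⇔numerator≡ A B C k = mk⇔
    (λ eq → *-cancelʳ-≡ _ _ n (trans (sym cleared) (trans eq scaled)))
    (λ eq → trans cleared (trans (cong (_* n) eq) (sym scaled)))
    where
    cleared : (A * (y₁ * (y * n)) + (B * (y * n) + C * y₁) * y₂) * n
            ≡ (A * (y₁ * y * n) + B * (y₂ * y * n) + C * (y₂ * y₁)) * n
    cleared = solve (A ∷ B ∷ C ∷ y₂ ∷ y₁ ∷ y ∷ n ∷ [])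
    scaled : k * (y₂ * (y₁ * (y * n))) ≡ k * (y₂ * y₁ * y) * n
    scaled = solve (k ∷ y₂ ∷ y₁ ∷ y ∷ n ∷ [])

  numerator-0-0≡⇒k≡0 : ∀ {C k} → C < y → numerator 0 0 C ≡ k * scale → k ≡ 0
  numerator-0-0≡⇒k≡0 {C} {k} C<y eq = m*n≡0⇒m≡0 k y (trans (sym C≡ky) (<∧∣⇒≡0 C<y (divides k C≡ky)))
    where
    regroup : k * (y₂ * y₁ * y) ≡ k * y * (y₂ * y₁)
    regroup = solve (k ∷ y₂ ∷ y₁ ∷ y ∷ [])
    C≡ky : C ≡ k * y
    C≡ky = *-cancelʳ-≡ C (k * y) (y₂ * y₁) (trans eq regroup)

  -- Reduced by y₁, the equation reads y n + C y₂ = k y₂ y: so y ∣ C y₂, whence C = 0.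
  numerator-1-0≡⇒n≡ky₂ : Coprime y y₂ → ∀ {C k} → C < y → numerator 1 0 C ≡ k * scale → n ≡ k * y₂
  numerator-1-0≡⇒n≡ky₂ coprime {C} {k} C<y eq = *-cancelʳ-≡ n (k * y₂) y (trans (*-comm n y) yn≡ky₂y)
    where
    regroup : k * (y₂ * y₁ * y) ≡ y₁ * (k * y₂ * y)
    regroup = solve (k ∷ y₂ ∷ y₁ ∷ y ∷ [])
    reduced : y * n + C * y₂ ≡ k * y₂ * y
    reduced = *-cancelˡ-≡ _ _ y₁ (trans (sym (numerator-1-0 C)) (trans eq regroup))
    C≡0 : C ≡ 0
    C≡0 = <∧∣⇒≡0 C<y (coprime-divisor coprime
      (subst (y ∣_) (*-comm C y₂) (∣m+n∣m⇒∣n (divides (k * y₂) reduced) (m∣m*n n))))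
    yn≡ky₂y : y * n ≡ k * y₂ * y
    yn≡ky₂y = begin
      y * n          ≡⟨ +-identityʳ (y * n) ⟨
      y * n + 0 * y₂ ≡⟨ cong (λ c → y * n + c * y₂) C≡0 ⟨
      y * n + C * y₂ ≡⟨ reduced ⟩
      k * y₂ * y     ∎

  FaithfulNumerators : ℕ → ℕ → Set
  FaithfulNumerators x m =
    ∀ A B C k → A ≤ 1 → B ≤ 1 → C ≤ x → numerator A B C ≡ k * scale → k ≡ 0 ⊎ k ≡ m

  module _ {x m : ℕ} (decomposition : numerator 1 1 x ≡ m * scale) where

    complement : ∀ {A B C A′ B′ k} → A + A′ ≡ 1 → B + B′ ≡ 1 → C ≤ x →
      numerator A B C ≡ k * scale → ∃[ l ] numerator A′ B′ (x ∸ C) ≡ l * scale × k + l ≡ m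
    complement {A} {B} {C} {A′} {B′} {k} A+A′≡1 B+B′≡1 C≤x eq = difference-of-multiples k m (begin
      k * scale + numerator A′ B′ (x ∸ C)          ≡⟨ cong (_+ numerator A′ B′ (x ∸ C)) eq ⟨
      numerator A B C + numerator A′ B′ (x ∸ C)    ≡⟨ numerator-+ A B C A′ B′ (x ∸ C) ⟩
      numerator (A + A′) (B + B′) (C + (x ∸ C))    ≡⟨ cong (numerator (A + A′) (B + B′)) (m+[n∸m]≡n C≤x) ⟩
      numerator (A + A′) (B + B′) x                ≡⟨ cong₂ (λ a b → numerator a b x) A+A′≡1 B+B′≡1 ⟩
      numerator 1 1 x                              ≡⟨ decomposition ⟩
      m * scale                                    ∎)

    mixed-sub-sum-impossible : Coprime y y₂ → (∀ m′ → 1 ≤ m′ → m′ < m → n ≢ m′ * y₂) →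
      ∀ {C D j l} → C < y → numerator 1 0 C ≡ j * scale → numerator 0 1 D ≡ l * scale → j + l ≡ m → ⊥
    mixed-sub-sum-impossible coprime no-small-multiple {C} {D} {j} {l} C<y part complementary j+l≡m =
      no-small-multiple j 1≤j j<m n≡jy₂
      where
      n≡jy₂ : n ≡ j * y₂
      n≡jy₂ = numerator-1-0≡⇒n≡ky₂ coprime {C} {j} C<y part
      1≤j : 1 ≤ j
      1≤j = n≢0⇒n>0 {j} (λ j≡0 → ≢-nonZero⁻¹ n (trans n≡jy₂ (cong (_* y₂) j≡0)))
      1≤l : 1 ≤ l
      1≤l = n≢0⇒n>0 {l} (λ l≡0 →
        1+n≢0 (proj₂ (numerator≡0⇒ {0} {1} {D} (trans complementary (cong (_* scale) l≡0)))))
      j<m : j < m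
      j<m = subst (j <_) j+l≡m (m<m+n j 1≤l)

    faithful⇒x<y : FaithfulNumerators x m → x < y
    faithful⇒x<y faithful with x <? y
    ... | yes x<y = x<y
    ... | no x≮y = ⊥-elim ([ (λ ()) , (λ 1≡m → m≢1 (sym 1≡m)) ]′ (faithful 0 0 y 1 z≤n z≤n y≤x y-third))
      where
      y≤x : y ≤ x
      y≤x = ≮⇒≥ x≮y
      y-third : y * (y₂ * y₁) ≡ 1 * (y₂ * y₁ * y)
      y-third = solve (y₂ ∷ y₁ ∷ y ∷ [])
      -- With m = 1, the complement 1/y₂ + 1/y₁ + (x − y)/(yn) of 1/n would vanish.
      m≢1 : m ≢ 1
      m≢1 m≡1 with complement {0} {0} {y} {1} {1} {1} refl refl y≤x y-third
      ... | l , rest , 1+l≡m =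
        1+n≢0 (proj₁ (numerator≡0⇒ {1} {1} {x ∸ y}
          (trans rest (cong (_* scale) (suc-injective (trans 1+l≡m m≡1))))))

    faithful⇒no-small-multiple : FaithfulNumerators x m → ∀ m′ → 1 ≤ m′ → m′ < m → n ≢ m′ * y₂
    faithful⇒no-small-multiple faithful m′ 1≤m′ m′<m n≡m′y₂ =
      [ (λ m′≡0 → <⇒≢ 1≤m′ (sym m′≡0)) , <⇒≢ m′<m ]′
        (faithful 1 0 0 m′ (s≤s z≤n) z≤n z≤n first-only)
      where
      regroup : y₁ * (y * (m′ * y₂) + 0 * y₂) ≡ m′ * (y₂ * y₁ * y)
      regroup = solve (m′ ∷ y₂ ∷ y₁ ∷ y ∷ [])
      first-only : numerator 1 0 0 ≡ m′ * scale
      first-only = begin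
        numerator 1 0 0                ≡⟨ numerator-1-0 0 ⟩
        y₁ * (y * n + 0 * y₂)          ≡⟨ cong (λ n′ → y₁ * (y * n′ + 0 * y₂)) n≡m′y₂ ⟩
        y₁ * (y * (m′ * y₂) + 0 * y₂)  ≡⟨ regroup ⟩
        m′ * scale                     ∎

    conditions⇒faithful : Coprime y y₂ → x < y → (∀ m′ → 1 ≤ m′ → m′ < m → n ≢ m′ * y₂) →
      FaithfulNumerators x m
    conditions⇒faithful _ x<y _ 0 0 C k _ _ C≤x eq = inj₁ (numerator-0-0≡⇒k≡0 (≤-<-trans C≤x x<y) eq)
    conditions⇒faithful _ x<y _ 1 1 C k _ _ C≤x eq
      with complement {1} {1} {C} {0} {0} {k} refl refl C≤x eq
    ... | l , rest , k+l≡m = inj₂ (begin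
      k      ≡⟨ +-identityʳ k ⟨
      k + 0  ≡⟨ cong (_+_ k) (numerator-0-0≡⇒k≡0 (≤-<-trans (m∸n≤m x C) x<y) rest) ⟨
      k + l  ≡⟨ k+l≡m ⟩
      m      ∎)
    conditions⇒faithful coprime x<y no-small-multiple 1 0 C k _ _ C≤x eq
      with complement {1} {0} {C} {0} {1} {k} refl refl C≤x eq
    ... | l , rest , k+l≡m =
      ⊥-elim (mixed-sub-sum-impossible coprime no-small-multiple {C} {x ∸ C} {k} {l}
        (≤-<-trans C≤x x<y) eq rest k+l≡m)
    conditions⇒faithful coprime x<y no-small-multiple 0 1 C k _ _ C≤x eq
      with complement {0} {1} {C} {1} {0} {k} refl refl C≤x eq
    ... | l , rest , k+l≡m =
      ⊥-elim (mixed-sub-sum-impossible coprime no-small-multiple {x ∸ C} {C} {l} {k}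
        (≤-<-trans (m∸n≤m x C) x<y) rest eq (trans (+-comm l k) k+l≡m))
    conditions⇒faithful _ _ _ (suc (suc _)) _ _ _ (s≤s ()) _ _ _
    conditions⇒faithful _ _ _ _ (suc (suc _)) _ _ _ (s≤s ()) _ _

    faithfulNumerators⇔ : Coprime y y₂ →
      FaithfulNumerators x m ⇔ (x < y × (∀ m′ → 1 ≤ m′ → m′ < m → n ≢ m′ * y₂))
    faithfulNumerators⇔ coprime = mk⇔
      (λ faithful → faithful⇒x<y faithful , faithful⇒no-small-multiple faithful)
      (λ (x<y , no-small-multiple) → conditions⇒faithful coprime x<y no-small-multiple)

-- Imported only here: the ring solver's variable lists above are built with Data.List's _∷_.
open import Data.Vec using (lookup; _∷_; [])

value₃ : ∀ (xs : Fin 3 → ℕ) a₀ a₁ a₂ →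
  value 3 xs (lookup (suc a₀ ∷ suc a₁ ∷ suc a₂ ∷ [])) ≡
  + (xs 0F * (suc a₁ * suc a₂) + (xs 1F * suc a₂ + xs 2F * suc a₁) * suc a₀) ÷ (suc a₀ * (suc a₁ * suc a₂))
value₃ xs a₀ a₁ a₂ = begin
  (+ xs 0F ÷ suc a₀) ℚ.+ ((+ xs 1F ÷ suc a₁) ℚ.+ ((+ xs 2F ÷ suc a₂) ℚ.+ ℚ.0ℚ))
    ≡⟨ cong (λ r → (+ xs 0F ÷ suc a₀) ℚ.+ ((+ xs 1F ÷ suc a₁) ℚ.+ r)) (ℚₚ.+-identityʳ (+ xs 2F ÷ suc a₂)) ⟩
  (+ xs 0F ÷ suc a₀) ℚ.+ ((+ xs 1F ÷ suc a₁) ℚ.+ (+ xs 2F ÷ suc a₂))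
    ≡⟨ cong ((+ xs 0F ÷ suc a₀) ℚ.+_) (+÷-+-+÷ (xs 1F) a₁ (xs 2F) a₂) ⟩
  (+ xs 0F ÷ suc a₀) ℚ.+ (+ (xs 1F * suc a₂ + xs 2F * suc a₁) ÷ (suc a₁ * suc a₂))
    ≡⟨ +÷-+-+÷ (xs 0F) a₀ (xs 1F * suc a₂ + xs 2F * suc a₁) (a₂ + a₁ * suc a₂) ⟩
  + (xs 0F * (suc a₁ * suc a₂) + (xs 1F * suc a₂ + xs 2F * suc a₁) * suc a₀) ÷ (suc a₀ * (suc a₁ * suc a₂)) ∎
  where open ≡-Reasoning

module _ (a₂ a₁ b c : ℕ) where
  open Numerators (suc a₂) (suc a₁) (suc b) (suc c)

  denominators : Fin 3 → ℕ
  denominators = lookup (suc a₂ ∷ suc a₁ ∷ suc b * suc c ∷ [])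

  cleared : (Fin 3 → ℕ) → ℕ
  cleared xs = xs 0F * (suc a₁ * (suc b * suc c)) + (xs 1F * (suc b * suc c) + xs 2F * suc a₁) * suc a₂

  value≡+÷⇔ : ∀ xs k → value 3 xs denominators ≡ + k ÷ suc c ⇔ numerator (xs 0F) (xs 1F) (xs 2F) ≡ k * scale
  value≡+÷⇔ xs k = mk⇔
    (λ eq → to (cleared⇔numerator≡ (xs 0F) (xs 1F) (xs 2F) k)
              (to (+÷≡+÷⇔ (cleared xs) _ k c) (trans (sym (value₃ xs a₂ a₁ (c + b * suc c))) eq)))
    (λ eq → trans (value₃ xs a₂ a₁ (c + b * suc c))
              (from (+÷≡+÷⇔ (cleared xs) _ k c) (from (cleared⇔numerator≡ (xs 0F) (xs 1F) (xs 2F) k) eq)))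

  value≢-÷ : ∀ xs k → value 3 xs denominators ≢ -[1+ k ] ÷ suc c
  value≢-÷ xs k eq = +÷≢-÷ (cleared xs) _ k c (trans (sym (value₃ xs a₂ a₁ (c + b * suc c))) eq)

  faithful⇔faithfulNumerators : ∀ x m →
    Faithful m (suc c) 3 (lookup (1 ∷ 1 ∷ x ∷ [])) denominators ⇔ FaithfulNumerators x m
  faithful⇔faithfulNumerators x m = mk⇔ necessary sufficient
    where
    necessary : Faithful m (suc c) 3 (lookup (1 ∷ 1 ∷ x ∷ [])) denominators → FaithfulNumerators x m
    necessary faithful A B C k A≤1 B≤1 C≤x eq =
      [ (λ v≡m/n → inj₂ (*-cancelʳ-≡ k m scale (trans (sym eq) (to (value≡+÷⇔ xs m) v≡m/n))))
      , (λ v≡0 → inj₁ (m*n≡0⇒m≡0 k scale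
                  (trans (sym eq) (to (value≡+÷⇔ xs 0) (trans v≡0 (sym (0/n≡0 (suc c))))))))
      ]′ (faithful xs bounded (+ k , from (value≡+÷⇔ xs k) eq))
      where
      xs : Fin 3 → ℕ
      xs = lookup (A ∷ B ∷ C ∷ [])
      bounded : ∀ i → xs i ≤ lookup (1 ∷ 1 ∷ x ∷ []) i
      bounded 0F = A≤1
      bounded 1F = B≤1
      bounded 2F = C≤x
    sufficient : FaithfulNumerators x m → Faithful m (suc c) 3 (lookup (1 ∷ 1 ∷ x ∷ [])) denominators
    sufficient faithful xs bounded (-[1+ k ] , eq) = ⊥-elim (value≢-÷ xs k eq)
    sufficient faithful xs bounded (+ k , eq) =
      [ (λ k≡0 → inj₂ (trans eq (trans (cong (λ j → + j ÷ suc c) k≡0) (0/n≡0 (suc c)))))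
      , (λ k≡m → inj₁ (trans eq (cong (λ j → + j ÷ suc c) k≡m)))
      ]′ (faithful (xs 0F) (xs 1F) (xs 2F) k (bounded 0F) (bounded 1F) (bounded 2F) (to (value≡+÷⇔ xs k) eq))

proposition5p1 : (m n y₁ y₂ y x : ℕ) →
    1 ≤ m → 1 ≤ n → Coprime m n →
    1 ≤ y₁ → 1 ≤ y₂ → 1 ≤ y → 1 ≤ x →
    Coprime y y₂ →
    y₂ ≢ y₁ → y₁ ≢ y * n → y₂ ≢ y * n →
    IsDecomposition m n 3 (lookup (1 ∷ 1 ∷ x ∷ [])) (lookup (y₂ ∷ y₁ ∷ y * n ∷ [])) →
    Faithful m n 3 (lookup (1 ∷ 1 ∷ x ∷ [])) (lookup (y₂ ∷ y₁ ∷ y * n ∷ []))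
      ⇔ ((x < y) × ((m′ : ℕ) → 1 ≤ m′ → m′ < m → n ≢ m′ * y₂))
proposition5p1 _ zero _ _ _ _ _ () _ _ _ _ _ _ _ _ _ _
proposition5p1 _ (suc _) zero _ _ _ _ _ _ () _ _ _ _ _ _ _ _
proposition5p1 _ (suc _) (suc _) zero _ _ _ _ _ _ () _ _ _ _ _ _ _
proposition5p1 _ (suc _) (suc _) (suc _) zero _ _ _ _ _ _ () _ _ _ _ _ _
proposition5p1 m (suc c) (suc a₁) (suc a₂) (suc b) x _ _ _ _ _ _ _ coprime _ _ _ (_ , _ , _ , m/n≡value) =
  ⇔-trans (faithful⇔faithfulNumerators a₂ a₁ b c x m) (faithfulNumerators⇔ decomposition coprime)
  where
  open Numerators (suc a₂) (suc a₁) (suc b) (suc c)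
  decomposition : numerator 1 1 x ≡ m * scale
  decomposition = to (value≡+÷⇔ a₂ a₁ b c (lookup (1 ∷ 1 ∷ x ∷ [])) m) (sym m/n≡value)
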